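{- For any pre-models $\mathfrak{M},\mathfrak{M}'$ with states $s,s'$, if $(\mathfrak{M},s)$ and $(\mathfrak{M}',s')$ are bisimilar then for every formula $\phi$ of $\mathcal{RCD}$, $\mathfrak{M},s\models_{\mathsf p}\phi$ iff $\mathfrak{M}',s'\models_{\mathsf p}\phi$.
   Context: Fix a finite set $\textsc{ag}$ of agents and a countable set $\textsc{prop}$ of propositional variables; $\textsc{gr}$ is the set of nonempty subsets of $\textsc{ag}$. $\mathcal{RCD}$: $\phi ::= p \mid \neg\phi \mid \phi\wedge\phi \mid K_i\phi \mid D_G\phi \mid C_G\phi \mid R_G\phi$. A pre-model is $\mathfrak{M}=(S,\backsim,V)$ where $S$ is nonempty, $\backsim$ assigns to every agent $i$ an equivalence relation $\backsim_i$ and to every group $G$ an equivalence relation $\backsim_G$ on $S$ (primitive), $V:\textsc{prop}\to\wp(S)$; $\backsim_{C_G}$ is the reflexive transitive closure of $\bigcup_{i\in G}\backsim_i$. Update: $\mathfrak{M}|_G=(S,\backsim|_G,V)$ with $(\backsim|_G)_i=\backsim_G$ if $i\in G$, else $\backsim_i$; $(\backsim|_G)_H=\backsim_{H\cup G}$ if $H\cap G\neq\emptyset$, else $\backsim_H$. Pseudo satisfaction $\models_{\mathsf p}$: atoms via $V$; Booleans as usual; $K_i\phi$ at $s$ iff $\phi$ at all $t$ with $s\backsim_it$; $D_G\phi$ iff $\phi$ at all $t$ with $s\backsim_Gt$; $C_G\phi$ iff $\phi$ at all $t$ with $s\backsim_{C_G}t$; $\mathfrak{M},s\models_{\mathsf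 p}R_G\phi$ iff $\mathfrak{M}|_G,s\models_{\mathsf p}\phi$. A bisimulation between pre-models $\mathfrak{M},\mathfrak{M}'$ is a nonempty $Z\subseteq S\times S'$ such that whenever $sZs'$: same atoms hold; for every $\tau\in\textsc{ag}\cup\textsc{gr}$ and $t$ with $s\backsim_\tau t$ there is $t'$ with $s'\backsim'_\tau t'$ and $tZt'$; and conversely for $t'$ with $s'\backsim'_\tau t'$. Pointed pre-models are bisimilar if some bisimulation links the points. -}

module Defs where

open import Data.Nat using (ℕ)
open import Data.Fin using (Fin)
open import Data.Fin.Subset using (Subset; Nonempty; _∈_; _∪_; _∩_)
open import Data.Fin.Subset.Properties using (nonempty?; q⊆p∪q)
open import Data.Product using (Σ; ∃; ∃-syntax; _×_; _,_; proj₁; proj₂)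
open import Relation.Nullary using (¬_; yes; no)
open import Relation.Binary using (IsEquivalence)
open import Relation.Binary.Construct.Closure.ReflexiveTransitive using (Star)

Group : ℕ → Set
Group n = Σ (Subset n) Nonempty

data Form (n : ℕ) : Set where
  atom : ℕ → Form n
  ¬'_  : Form n → Form n
  _∧'_ : Form n → Form n → Form n
  K    : Fin n → Form n → Form n
  D    : Group n → Form n → Form n
  C    : Group n → Form n → Form n
  R    : Group n → Form n → Form n

-- Pre-models.  The group relation is indexed by a subset together with an
-- (irrelevant) proof of its nonemptiness, so it is a function of the group only.
record PreModel (n : ℕ) : Set₁ where
  field
    S      : Set
    inhab  : S
    ∼ag    : Fin n → S → S → Set
    ∼gr    : (G : Subset n) → .(Nonempty G) → S → S → Set
    ∼ag-eq : ∀ i → IsEquivalence (∼ag i)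
    ∼gr-eq : ∀ G .(ne : Nonempty G) → IsEquivalence (∼gr G ne)
    V      : ℕ → S → Set

  ∼G : Group n → S → S → Set
  ∼G (G , ne) = ∼gr G ne

  ∼∪ : Group n → S → S → Set
  ∼∪ (G , _) s t = ∃[ i ] (i ∈ G × ∼ag i s t)

  ∼C : Group n → S → S → Set
  ∼C G = Star (∼∪ G)

open PreModel

private
  ∪-nonempty : ∀ {n} (H G : Subset n) → Nonempty G → Nonempty (H ∪ G)
  ∪-nonempty H G (x , x∈G) = x , q⊆p∪q H G x∈G

update : ∀ {n} → PreModel n → Group n → PreModel n
update {n} M (G , neG) = record
  { S = S M
  ; inhab = inhab M
  ; ∼ag = ag
  ; ∼gr = gr
  ; ∼ag-eq = ag-eq
  ; ∼gr-eq = gr-eq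
  ; V = V M
  }
  where
  open import Data.Fin.Subset.Properties using (_∈?_)
  ag : Fin n → S M → S M → Set
  ag i with i ∈? G
  ... | yes _ = ∼gr M G neG
  ... | no  _ = ∼ag M i
  ag-eq : ∀ i → IsEquivalence (ag i)
  ag-eq i with i ∈? G
  ... | yes _ = ∼gr-eq M G neG
  ... | no  _ = ∼ag-eq M i
  gr : (H : Subset n) → .(Nonempty H) → S M → S M → Set
  gr H neH with nonempty? (H ∩ G)
  ... | yes _ = ∼gr M (H ∪ G) (∪-nonempty H G neG)
  ... | no  _ = ∼gr M H neH
  gr-eq : ∀ H .(ne : Nonempty H) → IsEquivalence (gr H ne)
  gr-eq H neH with nonempty? (H ∩ G)
  ... | yes _ = ∼gr-eq M (H ∪ G) (∪-nonempty H G neG)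
  ... | no  _ = ∼gr-eq M H neH

_,_⊨_ : ∀ {n} (M : PreModel n) → S M → Form n → Set
M , s ⊨ atom p = V M p s
M , s ⊨ (¬' φ) = ¬ (M , s ⊨ φ)
M , s ⊨ (φ ∧' ψ) = (M , s ⊨ φ) × (M , s ⊨ ψ)
M , s ⊨ K i φ = ∀ t → ∼ag M i s t → M , t ⊨ φ
M , s ⊨ D G φ = ∀ t → ∼G M G s t → M , t ⊨ φ
M , s ⊨ C G φ = ∀ t → ∼C M G s t → M , t ⊨ φ
M , s ⊨ R G φ = update M G , s ⊨ φ

record IsBisimulation {n} (M M' : PreModel n) (Z : S M → S M' → Set) : Set where
  field
    nonempty : ∃[ s ] ∃[ s' ] Z s s'
    atoms    : ∀ {s s'} → Z s s' → ∀ p → (V M p s → V M' p s') × (V M' p s' → V M p s)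
    forth-ag : ∀ {s s'} → Z s s' → ∀ i t → ∼ag M i s t → ∃[ t' ] (∼ag M' i s' t' × Z t t')
    back-ag  : ∀ {s s'} → Z s s' → ∀ i t' → ∼ag M' i s' t' → ∃[ t ] (∼ag M i s t × Z t t')
    forth-gr : ∀ {s s'} → Z s s' → ∀ G t → ∼G M G s t → ∃[ t' ] (∼G M' G s' t' × Z t t')
    back-gr  : ∀ {s s'} → Z s s' → ∀ G t' → ∼G M' G s' t' → ∃[ t ] (∼G M G s t × Z t t')

Bisimilar : ∀ {n} (M : PreModel n) → S M → (M' : PreModel n) → S M' → Set₁
Bisimilar M s M' s' = ∃[ Z ] (IsBisimulation M M' Z × Z s s')

-- A bisimulation transports truth along every modality: K_i and D_G are
-- handled by the back-and-forth clauses, C_G by lifting the forth clause of the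
-- individual relations along paths, and R_G because a bisimulation between two
-- models is still a bisimulation between their G-updates (the updated relations
-- are relations of the original models).  The backward direction of each step
-- is the forward one for the converse bisimulation.
module Submission where

open import Defs
open import Data.Nat using (ℕ)
open import Data.Product using (_×_; _,_; ∃-syntax; proj₁; swap; map)
open import Data.Fin.Subset using (_∪_; _∩_)
open import Data.Fin.Subset.Properties using (nonempty?; q⊆p∪q; _∈?_)
open import Function using (flip)
open import Relation.Nullary using (yes; no)
open import Relation.Binary.Construct.Closure.ReflexiveTransitive using (Star; ε; _◅_)

open PreModel
open IsBisimulation

Forth : {A B : Set} → (A → A → Set) → (B → B → Set) → (A → B → Set) → Set
Forth _∼_ _∼′_ Z = ∀ {s s' t} → Z s s' → s ∼ t → ∃[ t' ] (s' ∼′ t' × Z t t')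

Star-forth : {A B : Set} {_∼_ : A → A → Set} {_∼′_ : B → B → Set} {Z : A → B → Set} →
             Forth _∼_ _∼′_ Z → Forth (Star _∼_) (Star _∼′_) Z
Star-forth forth z ε = _ , ε , z
Star-forth forth z (r ◅ rs) with forth z r
... | _ , r' , z' with Star-forth forth z' rs
...   | t' , rs' , zt = t' , r' ◅ rs' , zt

module _ {n : ℕ} {M M' : PreModel n} {Z : S M → S M' → Set} (B : IsBisimulation M M' Z) where

  converse : IsBisimulation M' M (flip Z)
  converse = record
    { nonempty = let s , s' , z = nonempty B in s' , s , z
    ; atoms    = λ z p → swap (atoms B z p)
    ; forth-ag = back-ag B
    ; back-ag  = forth-ag B
    ; forth-gr = back-gr B
    ; back-gr  = forth-gr B
    }

  ∼C-forth : ∀ G → Forth (∼C M G) (∼C M' G) Z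
  ∼C-forth G = Star-forth λ { z (i , i∈G , r) →
    let t' , r' , zt = forth-ag B z i _ r in t' , (i , i∈G , r') , zt }

  update-∼ag-forth : ∀ G i → Forth (∼ag (update M G) i) (∼ag (update M' G) i) Z
  update-∼ag-forth (G , neG) i z r with i ∈? G
  ... | yes _ = forth-gr B z (G , neG) _ r
  ... | no  _ = forth-ag B z i _ r

  update-∼G-forth : ∀ G H → Forth (∼G (update M G) H) (∼G (update M' G) H) Z
  update-∼G-forth (G , x , x∈G) (H , neH) z r with nonempty? (H ∩ G)
  ... | yes _ = forth-gr B z (H ∪ G , x , q⊆p∪q H G x∈G) _ r
  ... | no  _ = forth-gr B z (H , neH) _ r

update-bisimulation : ∀ {n} {M M' : PreModel n} {Z : S M → S M' → Set} →
                      IsBisimulation M M' Z → ∀ G → IsBisimulation (update M G) (update M' G) Z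
update-bisimulation B G = record
  { nonempty = nonempty B
  ; atoms    = atoms B
  ; forth-ag = λ z i _ → update-∼ag-forth B G i z
  ; back-ag  = λ z i _ → update-∼ag-forth (converse B) G i z
  ; forth-gr = λ z H _ → update-∼G-forth B G H z
  ; back-gr  = λ z H _ → update-∼G-forth (converse B) G H z
  }

□-transfer : {A B : Set} {_∼_ : A → A → Set} {_∼′_ : B → B → Set} {Z : A → B → Set}
             {P : A → Set} {P′ : B → Set} →
             Forth _∼′_ _∼_ (flip Z) → (∀ {t t'} → Z t t' → P t → P′ t') →
             ∀ {s s'} → Z s s' → (∀ t → s ∼ t → P t) → ∀ t' → s' ∼′ t' → P′ t'
□-transfer back transfer z □P t' r' with back z r'
... | t , r , zt = transfer zt (□P t r)

⊨-transfer : ∀ {n} {M M' : PreModel n} {Z : S M → S M' → Set} → IsBisimulation M M' Z →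
             ∀ φ {s s'} → Z s s' → M , s ⊨ φ → M' , s' ⊨ φ
⊨-transfer B (atom p) z = proj₁ (atoms B z p)
⊨-transfer B (¬' φ) z ¬φ φ′ = ¬φ (⊨-transfer (converse B) φ z φ′)
⊨-transfer B (φ ∧' ψ) z = map (⊨-transfer B φ z) (⊨-transfer B ψ z)
⊨-transfer B (K i φ) = □-transfer (λ z r → back-ag B z i _ r) (⊨-transfer B φ)
⊨-transfer B (D G φ) = □-transfer (λ z r → back-gr B z G _ r) (⊨-transfer B φ)
⊨-transfer B (C G φ) = □-transfer (∼C-forth (converse B) G) (⊨-transfer B φ)
⊨-transfer B (R G φ) = ⊨-transfer (update-bisimulation B G) φ

corollary2 : ∀ {n : ℕ} (M M' : PreModel n) (s : PreModel.S M) (s' : PreModel.S M') → Bisimilar M s M' s' → (φ : Form n) → ((M , s ⊨ φ) → (M' , s' ⊨ φ)) × ((M' , s' ⊨ φ) → (M , s ⊨ φ))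
corollary2 M M' s s' (Z , B , z) φ = ⊨-transfer B φ z , ⊨-transfer (converse B) φ z
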